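{- Let $\mathcal A=\{H_0,\dots,H_n\}$ be a central arrangement in $\mathbb C^{\ell+1}$, $0\le i<j\le n$, $1\le p\le\ell$, and let $\tau_{ij}:\mathcal F^p_{(i)}\to\mathcal F^p_{(j)}$ be as in the context. Let $[X_0<\cdots<X_p]\in\mathcal F^p$ with $H_i\not\le X_p$. (a) If $H_j\not\le X_p$, then $\tau_{ij}([X_0<\cdots<X_p])=[X_0<\cdots<X_p]$. (b) If $H_j\le X_p$ and $H_j\not\le X_{p-1}$, then \[ \tau_{ij}([X_0<\cdots<X_p])=-\sum_{\substack{X'\in L,\ \operatorname{codim}X'=p\\ X_{p-1}<X',\ X'\neq X_p}}[X_0<\cdots<X_{p-1}<X']. \]
   Context: $\mathcal A=\{H_0,\dots,H_n\}$ is a central arrangement of distinct hyperplanes in $\mathbb C^{\ell+1}$. $L$ is the set of intersections of subfamilies of $\mathcal A$ (including $\mathbb C^{\ell+1}$), partially ordered by reverse inclusion ($X\le Y$ iff $Y\subseteq X$; so $H\le X$ means $X\subseteq H$). A flag of length $p$ is a chain $(X_0<\cdots<X_p)$ in $L$ with $\operatorname{codim}X_r=r$. The flag space $\mathcal F=\bigoplus_p\mathcal F^p$ is the span of flags modulo all sums $\sum_Y(X_0<\cdots<X_{r-1}<Y<X_{r+1}<\cdots<X_p)$ over $Y\in L$ with $X_{r-1}<Y<X_{r+1}$, $\operatorname{codim}Y=r$; images written $[X_0<\cdots<X_p]$. The flag differential is $d[X_0<\cdots<X_p]=\sum_{X>X_p,\ \operatorname{codim}X=p+1}[X_0<\cdots<X_p<X]$,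 $\bar{\mathcal F}=\mathcal F/\operatorname{im}(d)$, $\pi:\mathcal F\to\bar{\mathcal F}$ the projection. For $X\in L$ of codimension $p$, $\mathcal F^p_X$ is the image in $\mathcal F^p$ of the span of flags ending at $X$. For each $k$ and $0\le p\le\ell$ put $\mathcal F^p_{(k)}=\bigoplus_{\operatorname{codim}X=p,\ H_k\not\le X}\mathcal F^p_X\subseteq\mathcal F^p$; the paper shows that $\pi$ restricts to an isomorphism $\mathcal F^p_{(k)}\to\bar{\mathcal F}^p$. Then $\tau_{ij}:\mathcal F^p_{(i)}\to\mathcal F^p_{(j)}$ sends $F$ to the unique element of $\mathcal F^p_{(j)}$ with the same image under $\pi$ as $F$ (this is the transition map between the dehomogenizations relative to $H_i$ and $H_j$). -}

module Defs where

open import Level using (0ℓ)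
open import Algebra.Bundles using (CommutativeRing)
open import Data.Nat using (ℕ; zero; suc) renaming (_+_ to _+ℕ_)
open import Data.Fin using (Fin; zero; suc)
open import Data.Fin.Subset using (Subset; _∈_)
open import Data.Bool using (Bool; true; false; if_then_else_)
import Data.Bool.Properties as BoolP
open import Data.Vec.Properties using (≡-dec)
open import Data.List using (List; []; _∷_; _++_; map; foldr; concatMap)
open import Data.List.Relation.Unary.All using (All)
open import Data.List.Relation.Unary.Any using (Any)
open import Data.List.Relation.Unary.AllPairs using (AllPairs)
open import Data.Product using (Σ; ∃; _×_; _,_)
open import Data.Sum using (_⊎_)
open import Data.Unit using (⊤)
open import Data.Empty using (⊥)
open import Relation.Nullary using (¬_; does)
open import Relation.Binary.PropositionalEquality using (_≡_)

module _ (K : CommutativeRing 0ℓ 0ℓ) where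
  open CommutativeRing K using (Carrier; _≈_; _+_; _*_; 0#; 1#)

  IsField : Set
  IsField = (¬ (0# ≈ 1#)) × (∀ x → ¬ (x ≈ 0#) → ∃ λ y → x * y ≈ 1#)

  natK : ℕ → Carrier
  natK zero    = 0#
  natK (suc m) = 1# + natK m

  CharZero : Set
  CharZero = ∀ m → ¬ (natK (suc m) ≈ 0#)

  -- Horner evaluation of the monic polynomial
  --   x^m + c₁ x^(m-1) + ... + c_m   (coefficients listed c₁ … c_m)
  horner : Carrier → List Carrier → Carrier → Carrier
  horner acc []       x = acc
  horner acc (c ∷ cs) x = horner (acc * x + c) cs x

  AlgClosed : Set
  AlgClosed = ∀ c cs → ∃ λ x → horner 1# (c ∷ cs) x ≈ 0#

  sumK : (m : ℕ) → (Fin m → Carrier) → Carrier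
  sumK zero    f = 0#
  sumK (suc m) f = f zero + sumK m (λ i → f (suc i))

  KVec : ℕ → Set
  KVec m = Fin m → Carrier

  apply : ∀ {m} → KVec m → KVec m → Carrier
  apply {m} a v = sumK m (λ x → a x * v x)

-- A central arrangement {H₀,…,Hₙ} of distinct hyperplanes in K^(ℓ+1):
-- H_k is the kernel of the nonzero linear form  form k.

record Arrangement (K : CommutativeRing 0ℓ 0ℓ) (ℓ n : ℕ) : Set where
  open CommutativeRing K using (_≈_; 0#)
  field
    form     : Fin (suc n) → KVec K (suc ℓ)
    nonzero  : ∀ k → ∃ λ x → ¬ (form k x ≈ 0#)
    distinct : ∀ k m → ¬ (k ≡ m) →
               ¬ (∀ (v : KVec K (suc ℓ)) →
                    (apply K (form k) v ≈ 0# → apply K (form m) v ≈ 0#) ×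
                    (apply K (form m) v ≈ 0# → apply K (form k) v ≈ 0#))

module Arr {K : CommutativeRing 0ℓ 0ℓ} {ℓ n : ℕ} (A : Arrangement K ℓ n) where
  open CommutativeRing K using (Carrier; _≈_; _+_; _*_; -_; 0#; 1#)
  open Arrangement A

  V : Set
  V = KVec K (suc ℓ)

  InH : Fin (suc n) → V → Set
  InH k v = apply K (form k) v ≈ 0#

  InX : Subset (suc n) → V → Set
  InX S v = ∀ k → k ∈ S → InH k v

  -- Each X ∈ L is recorded by
  -- the set of hyperplanes containing it, {k | X ⊆ H_k} (a "closed" set S
  -- with X = ⋂_{k∈S} H_k); this is a bijective encoding of L, and the
  -- empty set encodes the whole space K^(ℓ+1).
  record LE : Set where
    field
      hyps   : Subset (suc n)
      closed : ∀ k → (∀ v → InX hyps v → InH k v) → k ∈ hyps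
  open LE public

  _∋_ : LE → V → Set
  X ∋ v = InX (hyps X) v

  _≤L_ : LE → LE → Set
  X ≤L Y = ∀ v → Y ∋ v → X ∋ v

  _≈L_ : LE → LE → Set
  X ≈L Y = (X ≤L Y) × (Y ≤L X)

  _<L_ : LE → LE → Set
  X <L Y = (X ≤L Y) × ¬ (X ≈L Y)

  -- H_k ≤ X, i.e. X ⊆ H_k
  Under : Fin (suc n) → LE → Set
  Under k X = ∀ v → X ∋ v → InH k v

  lincomb : ∀ {d} → (Fin d → Carrier) → (Fin d → V) → V
  lincomb {d} c b x = sumK K d (λ i → c i * b i x)

  HasDim : LE → ℕ → Set
  HasDim X d =
    Σ (Fin d → V) λ b →
      (∀ i → X ∋ b i) ×
      (∀ c → (∀ x → lincomb c b x ≈ 0#) → ∀ i → c i ≈ 0#) ×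
      (∀ v → X ∋ v → ∃ λ c → ∀ x → v x ≈ lincomb c b x)

  HasCodim : LE → ℕ → Set
  HasCodim X r = ∃ λ d → HasDim X d × (d +ℕ r ≡ suc ℓ)

  ChainFrom : ℕ → List LE → Set
  ChainFrom k []            = ⊤
  ChainFrom k (X ∷ [])      = HasCodim X k
  ChainFrom k (X ∷ Y ∷ Zs)  = HasCodim X k × X <L Y × ChainFrom (suc k) (Y ∷ Zs)

  IsFlag : ℕ → List LE → Set
  IsFlag p fl = Data.List.length fl ≡ suc p × ChainFrom 0 fl

  LastNotUnder : Fin (suc n) → List LE → Set
  LastNotUnder k []            = ⊥
  LastNotUnder k (X ∷ [])      = ¬ Under k X
  LastNotUnder k (X ∷ Y ∷ Zs)  = LastNotUnder k (Y ∷ Zs)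

  Enumerates : (LE → Set) → List LE → Set
  Enumerates P ys =
    All P ys × (∀ Y → P Y → Any (λ Z → Z ≈L Y) ys) ×
    AllPairs (λ Y Z → ¬ (Y ≈L Z)) ys

  -- Formal K-linear combinations of flags (the free vector space on flags).

  FS : Set
  FS = List (Carrier × List LE)

  eqLE : LE → LE → Bool
  eqLE X Y = does (≡-dec BoolP._≟_ (hyps X) (hyps Y))

  eqFlag : List LE → List LE → Bool
  eqFlag []       []       = true
  eqFlag (X ∷ xs) (Y ∷ ys) = if eqLE X Y then eqFlag xs ys else false
  eqFlag _        _        = false

  coeff : List LE → FS → Carrier
  coeff f = foldr (λ { (a , g) acc → if eqFlag g f then a + acc else acc }) 0#

  scale : Carrier → FS → FS
  scale a = map (λ { (b , g) → (a * b , g) })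

  _-FS_ : FS → FS → FS
  xs -FS ys = xs ++ scale (- 1#) ys

  -- generators of the relations defining 𝓕:
  --   Σ_Y (X₀<⋯<X_{r-1}<Y<X_{r+1}<⋯<X_p),  1 ≤ r ≤ p-1,
  -- with X_{r-1} = B, X_{r+1} = C, r = 1 + length pre.
  data RelGen : Set where
    relGen : (p : ℕ) (pre : List LE) (B X C : LE) (post : List LE) →
             IsFlag p (pre ++ B ∷ X ∷ C ∷ post) →
             (ys : List LE) →
             Enumerates (λ Y → HasCodim Y (suc (Data.List.length pre)) ×
                               B <L Y × Y <L C) ys →
             RelGen

  relExpand : RelGen → FS
  relExpand (relGen p pre B X C post _ ys _) =
    map (λ Y → (1# , pre ++ B ∷ Y ∷ C ∷ post)) ys

  -- generators of im(d):  d(X₀<⋯<X_q) = Σ_{X > X_q, codim X = q+1} (X₀<⋯<X_q<X)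
  data DGen : Set where
    dGen : (q : ℕ) (pre : List LE) (Z : LE) →
           IsFlag q (pre ++ Z ∷ []) →
           (xs : List LE) →
           Enumerates (λ X → HasCodim X (suc q) × Z <L X) xs →
           DGen

  dExpand : DGen → FS
  dExpand (dGen q pre Z _ xs _) = map (λ X → (1# , pre ++ Z ∷ X ∷ [])) xs

  InSpan : {G : Set} → (G → FS) → FS → Set
  InSpan {G} ex xs =
    Σ (List (Carrier × G)) λ gs →
      ∀ f → coeff f xs ≈ coeff f (concatMap (λ { (a , g) → scale a (ex g) }) gs)

  allExpand : RelGen ⊎ DGen → FS
  allExpand (Data.Sum.inj₁ r) = relExpand r
  allExpand (Data.Sum.inj₂ d) = dExpand d

  -- equality in the flag space 𝓕
  _≈𝓕_ : FS → FS → Set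
  xs ≈𝓕 ys = InSpan relExpand (xs -FS ys)

  -- π xs = π ys in 𝓕̄ = 𝓕 / im d
  _≈𝓕̄_ : FS → FS → Set
  xs ≈𝓕̄ ys = InSpan allExpand (xs -FS ys)

  -- the class of xs lies in 𝓕^p_(k) = ⊕_{codim X = p, H_k ≰ X} 𝓕^p_X
  In𝓕 : Fin (suc n) → ℕ → FS → Set
  In𝓕 k p xs =
    Σ FS λ ys → All (λ { (a , f) → IsFlag p f × LastNotUnder k f }) ys × (xs ≈𝓕 ys)

  -- τ_ij(xs) = ys : ys is the element of 𝓕^p_(j) with π ys = π xs
  Tau : Fin (suc n) → Fin (suc n) → ℕ → FS → FS → Set
  Tau i j p xs ys = In𝓕 j p ys × (xs ≈𝓕̄ ys)

  ⟦_⟧ : List LE → FS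
  ⟦ f ⟧ = (1# , f) ∷ []

  negSum : (LE → List LE) → List LE → FS
  negSum fl ys = map (λ X′ → (- 1# , fl X′)) ys

-- (a) is immediate: a flag ending outside H_j already lies in 𝓕^p_(j).
-- (b) The flags X₀<⋯<X_{p-1}<X′, over all X′ of codimension p above X_{p-1},
-- sum to d[X₀<⋯<X_{p-1}], which vanishes in 𝓕̄.  Hence [X₀<⋯<X_p] and minus
-- the sum over X′ ≠ X_p have the same image under π, and the latter lies in
-- 𝓕^p_(j): since H_j ≰ X_{p-1}, the space X_{p-1} ∩ H_j has codimension p,
-- so it is the only element of codimension p above X_{p-1} inside H_j, and
-- that element is X_p.  The dimension count is a Steinitz exchange argument.
-- Equality in the field is not decidable, so it is carried out under double
-- negation, which is then removed using that the order on L is decidable.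

module Submission where

open import Defs
open import Level using (0ℓ)
open import Algebra.Bundles using (CommutativeRing)
open import Data.Nat using (ℕ; zero; suc; _≤_) renaming (_+_ to _+ℕ_)
import Data.Nat.Properties as ℕ
open import Data.Fin.Subset using (_⊆_)
open import Data.Fin.Subset.Properties using (_⊆?_)
open import Data.Fin using (Fin; zero; suc; punchIn; _<_)
open import Data.Fin.Properties using (all?; ¬∀⟶∃¬; ∀-cons)
open import Data.Vec.Functional using (insertAt) renaming (_∷_ to infixr 5 _∷ᵥ_)
open import Data.Vec.Functional.Properties using (insertAt-lookup; insertAt-punchIn)
open import Data.Product using (∃; _×_; _,_; proj₁; proj₂; swap)
open import Data.Bool using (true; false)
open import Data.List using (List; []; _∷_; _++_; length; map)
open import Data.List.Properties using (length-++; ++-identityʳ)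
open import Data.List.Relation.Unary.All using ([]; _∷_)
import Data.List.Relation.Unary.All as All
import Data.List.Relation.Unary.All.Properties as All
open import Data.List.Relation.Unary.Any using (Any; here; there)
open import Data.List.Relation.Binary.Pointwise using (Pointwise; []; _∷_)
open import Data.List.Relation.Unary.AllPairs using (_∷_)
open import Data.Sum using (_⊎_; inj₁; inj₂)
open import Data.Empty using (⊥)
open import Function using (_∘_; flip; id)
open import Relation.Nullary using (¬_; Dec; yes; no)
open import Relation.Nullary.Negation using (¬¬-map)
open import Relation.Nullary.Decidable using (¬¬-excluded-middle; map′; _×-dec_; decidable-stable)
import Relation.Binary.PropositionalEquality as P
open import Relation.Binary.PropositionalEquality using (_≡_)

¬¬-∀-Fin : ∀ n {Q : Fin n → Set} → (∀ i → ¬ ¬ Q i) → ¬ ¬ (∀ i → Q i)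
¬¬-∀-Fin zero    ¬¬Q ¬∀Q = ¬∀Q (λ ())
¬¬-∀-Fin (suc n) ¬¬Q ¬∀Q =
  ¬¬Q zero (λ Q₀ → ¬¬-∀-Fin n (¬¬Q ∘ suc) (λ Qₛ → ¬∀Q (∀-cons Q₀ Qₛ)))

¬¬-∃¬⊎∀ : ∀ n (Q : Fin n → Set) → ¬ ¬ ((∃ λ i → ¬ Q i) ⊎ (∀ i → Q i))
¬¬-∃¬⊎∀ n Q = ¬¬-map decide (¬¬-∀-Fin n (λ i → ¬¬-excluded-middle))
  where
  decide : (∀ i → Dec (Q i)) → (∃ λ i → ¬ Q i) ⊎ (∀ i → Q i)
  decide Q? with all? Q?
  ... | yes ∀Q = inj₂ ∀Q
  ... | no ¬∀Q = inj₁ (¬∀⟶∃¬ n Q Q? ¬∀Q)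

module LinearAlgebra (K : CommutativeRing 0ℓ 0ℓ) (isField : IsField K) (N : ℕ) where
  open CommutativeRing K renaming (Carrier to C) hiding (zero)
  open import Algebra.Properties.Ring ring using (-‿distribˡ-*; -‿distribʳ-*)
  open import Algebra.Properties.Semiring.Sum semiring
    using (sum; sum-cong-≋; sum-cong-≗; sum-replicate-zero; ∑-distrib-+; ∑-comm; sum-remove;
           *-distribˡ-sum; *-distribʳ-sum)
  open import Algebra.Properties.AbelianGroup +-abelianGroup using (inverseˡ-unique)
  open import Algebra.Properties.CommutativeSemigroup *-commutativeSemigroup using (x∙yz≈y∙xz)
  open import Relation.Binary.Reasoning.Setoid setoid

  ∑ : (m : ℕ) → (Fin m → C) → C
  ∑ = sumK K

  ∑≡sum : ∀ m (f : Fin m → C) → ∑ m f P.≡ sum f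
  ∑≡sum zero    f = P.refl
  ∑≡sum (suc m) f = P.cong (f zero +_) (∑≡sum m (f ∘ suc))

  ∑-cong : ∀ m {f g : Fin m → C} → (∀ i → f i ≈ g i) → ∑ m f ≈ ∑ m g
  ∑-cong m {f} {g} f≈g rewrite ∑≡sum m f | ∑≡sum m g = sum-cong-≋ f≈g

  ∑-zero : ∀ m {f : Fin m → C} → (∀ i → f i ≈ 0#) → ∑ m f ≈ 0#
  ∑-zero m {f} f≈0 rewrite ∑≡sum m f = trans (sum-cong-≋ f≈0) (sum-replicate-zero m)

  ∑-+ : ∀ m (f g : Fin m → C) → ∑ m (λ i → f i + g i) ≈ ∑ m f + ∑ m g
  ∑-+ m f g rewrite ∑≡sum m (λ i → f i + g i) | ∑≡sum m f | ∑≡sum m g = ∑-distrib-+ f g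

  ∑-*ˡ : ∀ m a (f : Fin m → C) → ∑ m (λ i → a * f i) ≈ a * ∑ m f
  ∑-*ˡ m a f rewrite ∑≡sum m (λ i → a * f i) | ∑≡sum m f = sym (*-distribˡ-sum a f)

  ∑-*ʳ : ∀ m a (f : Fin m → C) → ∑ m (λ i → f i * a) ≈ ∑ m f * a
  ∑-*ʳ m a f rewrite ∑≡sum m (λ i → f i * a) | ∑≡sum m f = sym (*-distribʳ-sum a f)

  ∑-swap : ∀ m n (F : Fin m → Fin n → C) → ∑ m (λ i → ∑ n (F i)) ≈ ∑ n (λ k → ∑ m (flip F k))
  ∑-swap m n F = begin
    ∑ m (λ i → ∑ n (F i))        ≡⟨ ∑²≡sum² m n F ⟩
    sum (λ i → sum (F i))        ≈⟨ ∑-comm F ⟩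
    sum (λ k → sum (flip F k))   ≡⟨ ∑²≡sum² n m (flip F) ⟨
    ∑ n (λ k → ∑ m (flip F k))   ∎
    where
    ∑²≡sum² : ∀ m n (F : Fin m → Fin n → C) → ∑ m (λ i → ∑ n (F i)) P.≡ sum (λ i → sum (F i))
    ∑²≡sum² m n F = P.trans (∑≡sum m _) (sum-cong-≗ (λ i → ∑≡sum n (F i)))

  ∑-remove : ∀ m (f : Fin (suc m) → C) i → ∑ (suc m) f ≈ f i + ∑ m (f ∘ punchIn i)
  ∑-remove m f i rewrite ∑≡sum (suc m) f | ∑≡sum m (f ∘ punchIn i) = sum-remove f

  1≉0 : ¬ (1# ≈ 0#)
  1≉0 = proj₁ isField ∘ sym

  cancel-invertibleʳ : ∀ {α β x} → α * β ≈ 1# → x * α ≈ 0# → x ≈ 0#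
  cancel-invertibleʳ {α} {β} {x} αβ≈1 xα≈0 = begin
    x             ≈⟨ *-identityʳ x ⟨
    x * 1#        ≈⟨ *-congˡ αβ≈1 ⟨
    x * (α * β)   ≈⟨ *-assoc x α β ⟨
    (x * α) * β   ≈⟨ *-congʳ xα≈0 ⟩
    0# * β        ≈⟨ zeroˡ β ⟩
    0#            ∎

  V : Set
  V = KVec K N

  _≈ᵥ_ : V → V → Set
  u ≈ᵥ v = ∀ x → u x ≈ v x

  0ᵥ : V
  0ᵥ _ = 0#

  lincomb : ∀ {d} → (Fin d → C) → (Fin d → V) → V
  lincomb {d} c b x = ∑ d (λ i → c i * b i x)

  Span : ∀ {d} → (Fin d → V) → V → Set
  Span b v = ∃ λ c → v ≈ᵥ lincomb c b

  Independent : ∀ {d} → (Fin d → V) → Set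
  Independent b = ∀ c → lincomb c b ≈ᵥ 0ᵥ → ∀ i → c i ≈ 0#

  -- Without decidable equality in K, this is the form of independence that
  -- survives Gaussian elimination.
  WeaklyIndependent : ∀ {d} → (Fin d → V) → Set
  WeaklyIndependent b = ∀ c → lincomb c b ≈ᵥ 0ᵥ → ∀ i → ¬ ¬ (c i ≈ 0#)

  lincomb-+ : ∀ {d} (c e : Fin d → C) (b : Fin d → V) →
              lincomb (λ i → c i + e i) b ≈ᵥ (λ x → lincomb c b x + lincomb e b x)
  lincomb-+ {d} c e b x = trans (∑-cong d (λ i → distribʳ (b i x) (c i) (e i))) (∑-+ d _ _)

  lincomb-* : ∀ {d} s (c : Fin d → C) (b : Fin d → V) →
              lincomb (λ i → s * c i) b ≈ᵥ (λ x → s * lincomb c b x)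
  lincomb-* {d} s c b x = trans (∑-cong d (λ i → *-assoc s (c i) (b i x))) (∑-*ˡ d s _)

  lincomb-tail : ∀ {d} (c : Fin (suc d) → C) (b : Fin (suc d) → V) → c zero ≈ 0# →
                 lincomb c b ≈ᵥ lincomb (c ∘ suc) (b ∘ suc)
  lincomb-tail c b c₀≈0 x =
    trans (+-congʳ (trans (*-congʳ c₀≈0) (zeroˡ (b zero x)))) (+-identityˡ _)

  apply-cong : ∀ f {u v : V} → u ≈ᵥ v → apply K f u ≈ apply K f v
  apply-cong f u≈v = ∑-cong N (λ x → *-congˡ (u≈v x))

  apply-0ᵥ : ∀ f {u : V} → u ≈ᵥ 0ᵥ → apply K f u ≈ 0#
  apply-0ᵥ f u≈0 = ∑-zero N (λ x → trans (*-congˡ (u≈0 x)) (zeroʳ (f x)))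

  apply-lincomb : ∀ {d} f (c : Fin d → C) (b : Fin d → V) →
                  apply K f (lincomb c b) ≈ ∑ d (λ i → c i * apply K f (b i))
  apply-lincomb {d} f c b = begin
    ∑ N (λ x → f x * ∑ d (λ i → c i * b i x))
      ≈⟨ ∑-cong N (λ x → ∑-*ˡ d (f x) _) ⟨
    ∑ N (λ x → ∑ d (λ i → f x * (c i * b i x)))
      ≈⟨ ∑-swap N d _ ⟩
    ∑ d (λ i → ∑ N (λ x → f x * (c i * b i x)))
      ≈⟨ ∑-cong d (λ i → ∑-cong N (λ x → x∙yz≈y∙xz (f x) (c i) (b i x))) ⟩
    ∑ d (λ i → ∑ N (λ x → c i * (f x * b i x)))
      ≈⟨ ∑-cong d (λ i → ∑-*ˡ N (c i) _) ⟩
    ∑ d (λ i → c i * apply K f (b i)) ∎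

  kernel-span : ∀ {d} f (b : Fin d → V) → (∀ i → apply K f (b i) ≈ 0#) →
                ∀ {v} → Span b v → apply K f v ≈ 0#
  kernel-span {d} f b fb≈0 (c , v≈) =
    trans (apply-cong f v≈)
      (trans (apply-lincomb f c b) (∑-zero d (λ i → trans (*-congˡ (fb≈0 i)) (zeroʳ (c i)))))

  span-tail : ∀ {d} {u : Fin (suc d) → V} {v} (c : Fin (suc d) → C) →
              v ≈ᵥ lincomb c u → c zero ≈ 0# → Span (u ∘ suc) v
  span-tail {u = u} c v≈ c₀≈0 = c ∘ suc , λ x → trans (v≈ x) (lincomb-tail c u c₀≈0 x)

  weaklyIndependent-tail : ∀ {d} {v : Fin (suc d) → V} →
                           WeaklyIndependent v → WeaklyIndependent (v ∘ suc)
  weaklyIndependent-tail {v = v} wi c c·v≈0 i =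
    wi (0# ∷ᵥ c) (λ x → trans (lincomb-tail (0# ∷ᵥ c) v refl x) (c·v≈0 x)) (suc i)

  module Elimination {m} (u : Fin (suc m) → V) (v : Fin (suc (suc m)) → V)
                     (a : Fin (suc (suc m)) → Fin (suc m) → C) (v≈ : ∀ i → v i ≈ᵥ lincomb (a i) u)
                     (i₀ : Fin (suc (suc m))) {β : C} (αβ≈1 : a i₀ zero * β ≈ 1#) where

    r : Fin (suc m) → C
    r k = a (punchIn i₀ k) zero * β

    v′ : Fin (suc m) → V
    v′ k x = v (punchIn i₀ k) x + - r k * v i₀ x

    v′-span : ∀ k → Span (u ∘ suc) (v′ k)
    v′-span k = span-tail {u = u} a′ v′≈ a′₀≈0
      where
      aₖ : Fin (suc m) → C
      aₖ = a (punchIn i₀ k)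

      a′ : Fin (suc m) → C
      a′ l = aₖ l + - r k * a i₀ l

      v′≈ : v′ k ≈ᵥ lincomb a′ u
      v′≈ x = begin
        v (punchIn i₀ k) x + - r k * v i₀ x
          ≈⟨ +-cong (v≈ (punchIn i₀ k) x) (*-congˡ (v≈ i₀ x)) ⟩
        lincomb aₖ u x + - r k * lincomb (a i₀) u x
          ≈⟨ +-congˡ (lincomb-* (- r k) (a i₀) u x) ⟨
        lincomb aₖ u x + lincomb (λ l → - r k * a i₀ l) u x
          ≈⟨ lincomb-+ aₖ (λ l → - r k * a i₀ l) u x ⟨
        lincomb a′ u x ∎

      a′₀≈0 : a′ zero ≈ 0#
      a′₀≈0 = begin
        aₖ zero + - r k * a i₀ zero     ≈⟨ +-congˡ (-‿distribˡ-* (r k) (a i₀ zero)) ⟨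
        aₖ zero + - (r k * a i₀ zero)   ≈⟨ +-congˡ (-‿cong rα≈aₖ) ⟩
        aₖ zero + - aₖ zero             ≈⟨ -‿inverseʳ (aₖ zero) ⟩
        0#                              ∎
        where
        rα≈aₖ : r k * a i₀ zero ≈ aₖ zero
        rα≈aₖ = begin
          (aₖ zero * β) * a i₀ zero  ≈⟨ *-assoc (aₖ zero) β (a i₀ zero) ⟩
          aₖ zero * (β * a i₀ zero)  ≈⟨ *-congˡ (trans (*-comm β (a i₀ zero)) αβ≈1) ⟩
          aₖ zero * 1#               ≈⟨ *-identityʳ (aₖ zero) ⟩
          aₖ zero                    ∎

    -- A relation among the v′ is a relation among the v, with coefficient S at i₀.
    v′-weaklyIndependent : WeaklyIndependent v → WeaklyIndependent v′
    v′-weaklyIndependent wi c c·v′≈0 k =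
      P.subst (λ t → ¬ ¬ (t ≈ 0#)) (insertAt-punchIn c i₀ S k) (wi c′ c′·v≈0 (punchIn i₀ k))
      where
      S : C
      S = ∑ (suc m) (λ k → c k * - r k)

      c′ : Fin (suc (suc m)) → C
      c′ = insertAt c i₀ S

      c′·v≈0 : lincomb c′ v ≈ᵥ 0ᵥ
      c′·v≈0 x = begin
        lincomb c′ v x
          ≈⟨ ∑-remove (suc m) (λ i → c′ i * v i x) i₀ ⟩
        c′ i₀ * v i₀ x + ∑ (suc m) (λ k → c′ (punchIn i₀ k) * v (punchIn i₀ k) x)
          ≈⟨ +-cong (*-congʳ (reflexive (insertAt-lookup c i₀ S)))
                    (∑-cong (suc m) λ k →
                       reflexive (P.cong (_* v (punchIn i₀ k) x) (insertAt-punchIn c i₀ S k))) ⟩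
        S * v i₀ x + ∑ (suc m) (λ k → c k * v (punchIn i₀ k) x)
          ≈⟨ +-comm _ _ ⟩
        ∑ (suc m) (λ k → c k * v (punchIn i₀ k) x) + S * v i₀ x
          ≈⟨ +-congˡ (∑-*ʳ (suc m) (v i₀ x) (λ k → c k * - r k)) ⟨
        ∑ (suc m) (λ k → c k * v (punchIn i₀ k) x) + ∑ (suc m) (λ k → (c k * - r k) * v i₀ x)
          ≈⟨ ∑-+ (suc m) (λ k → c k * v (punchIn i₀ k) x) (λ k → (c k * - r k) * v i₀ x) ⟨
        ∑ (suc m) (λ k → c k * v (punchIn i₀ k) x + (c k * - r k) * v i₀ x)
          ≈⟨ ∑-cong (suc m) (λ k → factor (c k) (v (punchIn i₀ k) x) (- r k) (v i₀ x)) ⟩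
        lincomb c v′ x
          ≈⟨ c·v′≈0 x ⟩
        0# ∎
        where
        factor : ∀ γ y ρ z → γ * y + (γ * ρ) * z ≈ γ * (y + ρ * z)
        factor γ y ρ z = trans (+-congˡ (*-assoc γ ρ z)) (sym (distribˡ γ y (ρ * z)))

  steinitz : ∀ m (u : Fin m → V) (v : Fin (suc m) → V) →
             (∀ i → Span u (v i)) → ¬ WeaklyIndependent v
  steinitz zero u v v∈ wi = wi (λ _ → 1#) 1·v≈0 zero 1≉0
    where
    1·v≈0 : lincomb (λ _ → 1#) v ≈ᵥ 0ᵥ
    1·v≈0 x = trans (+-identityʳ _) (trans (*-identityˡ _) (proj₂ (v∈ zero) x))
  steinitz (suc m) u v v∈ wi = ¬¬-∃¬⊎∀ _ (λ i → a i zero ≈ 0#) λ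
    { (inj₂ a₀≈0) → steinitz m (u ∘ suc) (v ∘ suc)
        (λ i → span-tail {u = u} (a (suc i)) (proj₂ (v∈ (suc i))) (a₀≈0 (suc i)))
        (weaklyIndependent-tail {v = v} wi)
    ; (inj₁ (i₀ , aᵢ₀≉0)) → eliminate i₀ (proj₂ isField _ aᵢ₀≉0) }
    where
    a : Fin (suc (suc m)) → Fin (suc m) → C
    a i = proj₁ (v∈ i)

    eliminate : ∀ i₀ → (∃ λ β → a i₀ zero * β ≈ 1#) → ⊥
    eliminate i₀ (β , αβ≈1) =
      steinitz m (u ∘ suc) v′ v′-span (v′-weaklyIndependent wi)
      where open Elimination u v a (proj₂ ∘ v∈) i₀ αβ≈1

  weaklyIndependent-∷-outside-span : ∀ {d} {b : Fin d → V} {v} →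
    Independent b → ¬ Span b v → WeaklyIndependent (v ∷ᵥ b)
  weaklyIndependent-∷-outside-span {d} {b} {v} indep v∉⟨b⟩ g g·vb≈0 =
    ∀-cons ¬¬g₀≈0 (λ i → ¬¬-map (λ g₀≈0 → indep (g ∘ suc) (g·b≈0 g₀≈0) i) ¬¬g₀≈0)
    where
    g·b≈0 : g zero ≈ 0# → lincomb (g ∘ suc) b ≈ᵥ 0ᵥ
    g·b≈0 g₀≈0 x = trans (sym (lincomb-tail g (v ∷ᵥ b) g₀≈0 x)) (g·vb≈0 x)

    v∈⟨b⟩ : (∃ λ η → g zero * η ≈ 1#) → Span b v
    v∈⟨b⟩ (η , g₀η≈1) = (λ i → - η * g (suc i)) , λ x → begin
      v x                                ≈⟨ *-identityˡ (v x) ⟨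
      1# * v x                           ≈⟨ *-congʳ (trans (*-comm η (g zero)) g₀η≈1) ⟨
      (η * g zero) * v x                 ≈⟨ *-assoc η (g zero) (v x) ⟩
      η * (g zero * v x)                 ≈⟨ *-congˡ (inverseˡ-unique _ _ (g·vb≈0 x)) ⟩
      η * - lincomb (g ∘ suc) b x        ≈⟨ -‿distribʳ-* η _ ⟨
      - (η * lincomb (g ∘ suc) b x)      ≈⟨ -‿distribˡ-* η _ ⟩
      - η * lincomb (g ∘ suc) b x        ≈⟨ lincomb-* (- η) (g ∘ suc) b x ⟨
      lincomb (λ i → - η * g (suc i)) b x ∎

    ¬¬g₀≈0 : ¬ ¬ (g zero ≈ 0#)
    ¬¬g₀≈0 g₀≉0 = v∉⟨b⟩ (v∈⟨b⟩ (proj₂ isField _ g₀≉0))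

  weaklyIndependent-∷-outside-kernel : ∀ {d} f {w : Fin d → V} {u β} →
    apply K f u * β ≈ 1# → (∀ i → apply K f (w i) ≈ 0#) →
    WeaklyIndependent w → WeaklyIndependent (u ∷ᵥ w)
  weaklyIndependent-∷-outside-kernel {d} f {w} {u} fuβ≈1 fw≈0 wi g g·uw≈0 =
    ∀-cons (λ g₀≉0 → g₀≉0 g₀≈0)
           (wi (g ∘ suc) (λ x → trans (sym (lincomb-tail g (u ∷ᵥ w) g₀≈0 x)) (g·uw≈0 x)))
    where
    g₀≈0 : g zero ≈ 0#
    g₀≈0 = cancel-invertibleʳ fuβ≈1 (begin
      g zero * apply K f u
        ≈⟨ +-identityʳ _ ⟨
      g zero * apply K f u + 0#
        ≈⟨ +-congˡ (∑-zero d (λ i → trans (*-congˡ (fw≈0 i)) (zeroʳ _))) ⟨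
      ∑ (suc d) (λ i → g i * apply K f ((u ∷ᵥ w) i))
        ≈⟨ apply-lincomb f g (u ∷ᵥ w) ⟨
      apply K f (lincomb g (u ∷ᵥ w))
        ≈⟨ apply-0ᵥ f g·uw≈0 ⟩
      0# ∎)

  -- Otherwise c i₀ (chosen outside ker f), v and b would be d+2 weakly
  -- independent vectors in the span of the d+1 vectors c.
  kernel-section-spanned :
    ∀ {d} (W : V → Set) (c : Fin (suc d) → V) → (∀ i → W (c i)) → (∀ v → W v → Span c v) →
    ∀ f → ¬ (∀ v → W v → apply K f v ≈ 0#) →
    (b : Fin d → V) → Independent b → (∀ i → W (b i)) → (∀ i → apply K f (b i) ≈ 0#) →
    ∀ v → W v → apply K f v ≈ 0# → ¬ ¬ Span b v
  kernel-section-spanned {d} W c c∈W W⊆⟨c⟩ f W⊈ker b indep b∈W fb≈0 v v∈W fv≈0 v∉⟨b⟩ =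
    ¬¬-∃¬⊎∀ _ (λ i → apply K f (c i) ≈ 0#) λ
      { (inj₂ fc≈0) → W⊈ker (λ w w∈W → kernel-span f c fc≈0 (W⊆⟨c⟩ w w∈W))
      ; (inj₁ (i₀ , fcᵢ₀≉0)) → too-many i₀ (proj₂ isField _ fcᵢ₀≉0) }
    where
    too-many : ∀ i₀ → (∃ λ β → apply K f (c i₀) * β ≈ 1#) → ⊥
    too-many i₀ (β , fcβ≈1) =
      steinitz (suc d) c (c i₀ ∷ᵥ v ∷ᵥ b)
        (λ i → W⊆⟨c⟩ _ (∀-cons {P = W ∘ (c i₀ ∷ᵥ v ∷ᵥ b)} (c∈W i₀) (∀-cons v∈W b∈W) i))
        (weaklyIndependent-∷-outside-kernel f {w = v ∷ᵥ b} fcβ≈1 (∀-cons fv≈0 fb≈0)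
          (weaklyIndependent-∷-outside-span indep v∉⟨b⟩))

module IntersectionLattice {K : CommutativeRing 0ℓ 0ℓ} (isField : IsField K)
                           {ℓ n : ℕ} (A : Arrangement K ℓ n) where
  open Arr A
  open Arrangement A using (form)
  open LinearAlgebra K isField (suc ℓ) using (Span; kernel-span; kernel-section-spanned)

  ≤L⇒⊆ : ∀ {X Y} → X ≤L Y → hyps X ⊆ hyps Y
  ≤L⇒⊆ {X} {Y} X≤Y {k} k∈X = closed Y k (λ v v∈Y → X≤Y v v∈Y k k∈X)

  ⊆⇒≤L : ∀ {X Y} → hyps X ⊆ hyps Y → X ≤L Y
  ⊆⇒≤L X⊆Y v v∈Y k k∈X = v∈Y k (X⊆Y k∈X)

  _≤L?_ : (X Y : LE) → Dec (X ≤L Y)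
  X ≤L? Y = map′ (⊆⇒≤L {X} {Y}) (≤L⇒⊆ {X} {Y}) (hyps X ⊆? hyps Y)

  _≈L?_ : (X Y : LE) → Dec (X ≈L Y)
  X ≈L? Y = (X ≤L? Y) ×-dec (Y ≤L? X)

  ∋-span : ∀ X {d} {b : Fin d → V} → (∀ i → X ∋ b i) → ∀ {v} → Span b v → X ∋ v
  ∋-span X {b = b} b∈X v∈⟨b⟩ k k∈X = kernel-span (form k) b (λ i → b∈X i k k∈X) v∈⟨b⟩

  hasDim-of-codim : ∀ {X r d} → HasCodim X r → d +ℕ r ≡ suc ℓ → HasDim X d
  hasDim-of-codim {r = r} {d} (d′ , dim , d′+r≡) d+r≡
    with ℕ.+-cancelʳ-≡ r d′ d (P.trans d′+r≡ (P.sym d+r≡))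
  ... | P.refl = dim

  -- Y ⊆ P ∩ H_j and both have dimension dim P - 1, so Y = P ∩ H_j ⊇ Z.
  hyperplane-cover-≤ : ∀ j {P Y Z q r} → HasCodim P q → HasCodim Y (suc q) → HasCodim Z r →
    P ≤L Y → P ≤L Z → Under j Y → Under j Z → ¬ Under j P → Y ≤L Z
  hyperplane-cover-≤ j {P} {Y} {Z} {q} codimP (dY , (b , b∈Y , b-indep , _) , dY+1+q≡)
                     (_ , (z , z∈Z , _ , Z⊆⟨z⟩) , _) P≤Y P≤Z Y⊆Hj Z⊆Hj P⊈Hj =
    decidable-stable (Y ≤L? Z) λ Y≰Z →
      ¬¬-∀-Fin _ z∈Y λ all-z∈Y → Y≰Z (λ v v∈Z → ∋-span Y all-z∈Y (Z⊆⟨z⟩ v v∈Z))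
    where
    dimP : HasDim P (suc dY)
    dimP = hasDim-of-codim {P} codimP (P.trans (P.sym (ℕ.+-suc dY q)) dY+1+q≡)

    z∈Y : ∀ k → ¬ ¬ (Y ∋ z k)
    z∈Y k = ¬¬-map (∋-span Y b∈Y)
      (kernel-section-spanned (P ∋_) c c∈P P⊆⟨c⟩ (form j) P⊈Hj b b-indep
         (λ i → P≤Y (b i) (b∈Y i)) (λ i → Y⊆Hj (b i) (b∈Y i))
         (z k) (P≤Z (z k) (z∈Z k)) (Z⊆Hj (z k) (z∈Z k)))
      where
      c : Fin (suc dY) → V
      c = proj₁ dimP

      c∈P : ∀ i → P ∋ c i
      c∈P = proj₁ (proj₂ dimP)

      P⊆⟨c⟩ : ∀ v → P ∋ v → Span c v
      P⊆⟨c⟩ = proj₂ (proj₂ (proj₂ dimP))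

  hyperplane-cover-unique : ∀ j {P Y Z q} →
    HasCodim P q → HasCodim Y (suc q) → HasCodim Z (suc q) →
    P ≤L Y → P ≤L Z → Under j Y → Under j Z → ¬ Under j P → Y ≈L Z
  hyperplane-cover-unique j {P} {Y} {Z} cP cY cZ P≤Y P≤Z Y⊆Hj Z⊆Hj P⊈Hj =
    hyperplane-cover-≤ j {P} {Y} {Z} cP cY cZ P≤Y P≤Z Y⊆Hj Z⊆Hj P⊈Hj ,
    hyperplane-cover-≤ j {P} {Z} {Y} cP cZ cY P≤Z P≤Y Z⊆Hj Y⊆Hj P⊈Hj

module FlagSpace {K : CommutativeRing 0ℓ 0ℓ} (isField : IsField K)
                 {ℓ n : ℕ} (A : Arrangement K ℓ n) where
  open Arr A
  open CommutativeRing K using (_≈_; _+_; _*_; -_; 0#; 1#; refl; sym; trans; +-cong; +-congˡ;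
    +-identityˡ; +-assoc; *-identityʳ; distribˡ; zeroʳ; -‿inverseʳ; ring; +-abelianGroup; setoid)
    renaming (Carrier to C)
  open import Algebra.Properties.Ring ring using (-1*x≈-x)
  open import Algebra.Properties.AbelianGroup +-abelianGroup using (⁻¹-involutive)
  open import Relation.Binary.Reasoning.Setoid setoid
  open IntersectionLattice isField A using (_≈L?_; hyperplane-cover-unique)

  chainFrom-∷⁻ : ∀ {k x} xs {y ys} → ChainFrom k (x ∷ xs ++ y ∷ ys) → ChainFrom (suc k) (xs ++ y ∷ ys)
  chainFrom-∷⁻ []      = proj₂ ∘ proj₂
  chainFrom-∷⁻ (_ ∷ _) = proj₂ ∘ proj₂

  chainFrom-last₂ : ∀ k xs {Y Z} → ChainFrom k (xs ++ Y ∷ Z ∷ []) →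
    HasCodim Y (k +ℕ length xs) × Y <L Z × HasCodim Z (suc (k +ℕ length xs))
  chainFrom-last₂ k []       ch rewrite ℕ.+-identityʳ k = ch
  chainFrom-last₂ k (x ∷ xs) ch rewrite ℕ.+-suc k (length xs) =
    chainFrom-last₂ (suc k) xs (chainFrom-∷⁻ xs ch)

  chainFrom-init : ∀ k xs {Y Z} → ChainFrom k (xs ++ Y ∷ Z ∷ []) → ChainFrom k (xs ++ Y ∷ [])
  chainFrom-init k []            = proj₁
  chainFrom-init k (x ∷ [])      (cx , x<Y , ch) = cx , x<Y , proj₁ ch
  chainFrom-init k (x ∷ x′ ∷ xs) (cx , x<x′ , ch) = cx , x<x′ , chainFrom-init (suc k) (x′ ∷ xs) ch

  chainFrom-replace-last : ∀ k xs {Y Z Z′} → ChainFrom k (xs ++ Y ∷ Z ∷ []) →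
    Y <L Z′ → HasCodim Z′ (suc (k +ℕ length xs)) → ChainFrom k (xs ++ Y ∷ Z′ ∷ [])
  chainFrom-replace-last k [] {Z′ = Z′} (cY , _) Y<Z′ cZ′ =
    cY , Y<Z′ , P.subst (HasCodim Z′ ∘ suc) (ℕ.+-identityʳ k) cZ′
  chainFrom-replace-last k (x ∷ []) {Y} {Z} {Z′} (cx , x<Y , ch) Y<Z′ cZ′ =
    cx , x<Y , chainFrom-replace-last (suc k) [] {Y} {Z} {Z′} ch Y<Z′
                 (P.subst (HasCodim Z′ ∘ suc) (ℕ.+-suc k 0) cZ′)
  chainFrom-replace-last k (x ∷ x′ ∷ xs) {Y} {Z} {Z′} (cx , x<x′ , ch) Y<Z′ cZ′ =
    cx , x<x′ , chainFrom-replace-last (suc k) (x′ ∷ xs) {Y} {Z} {Z′} ch Y<Z′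
                  (P.subst (HasCodim Z′ ∘ suc) (ℕ.+-suc k (length (x′ ∷ xs))) cZ′)

  flag-length : ∀ {p} pre {Y Z} → IsFlag p (pre ++ Y ∷ Z ∷ []) → p ≡ suc (length pre)
  flag-length pre (len , _) =
    ℕ.suc-injective (P.trans (P.sym len) (P.trans (length-++ pre) (ℕ.+-comm (length pre) 2)))

  flag-init : ∀ {p} pre {Y Z} → IsFlag p (pre ++ Y ∷ Z ∷ []) → IsFlag (length pre) (pre ++ Y ∷ [])
  flag-init pre (_ , ch) = P.trans (length-++ pre) (ℕ.+-comm (length pre) 1) , chainFrom-init 0 pre ch

  flag-replace-last : ∀ {p} pre {Y Z Z′} → IsFlag p (pre ++ Y ∷ Z ∷ []) →
    Y <L Z′ → HasCodim Z′ p → IsFlag p (pre ++ Y ∷ Z′ ∷ [])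
  flag-replace-last pre {Z′ = Z′} flag@(len , ch) Y<Z′ cZ′ =
    P.trans (length-++ pre) (P.trans (P.sym (length-++ pre)) len) ,
    chainFrom-replace-last 0 pre ch Y<Z′ (P.subst (HasCodim Z′) (flag-length pre flag) cZ′)

  lastNotUnder-++ : ∀ {k} xs {y ys} → LastNotUnder k (y ∷ ys) → LastNotUnder k (xs ++ y ∷ ys)
  lastNotUnder-++ []           = id
  lastNotUnder-++ (_ ∷ [])     = id
  lastNotUnder-++ (_ ∷ x ∷ xs) = lastNotUnder-++ (x ∷ xs)

  enumerates-∷ : ∀ {P Q : LE → Set} {Z ys} → P Z → Q Z →
    Enumerates (λ X → P X × Q X × ¬ (X ≈L Z)) ys → Enumerates (λ X → P X × Q X) (Z ∷ ys)
  enumerates-∷ {Z = Z} {ys} pZ qZ (all , complete , distinct) =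
    (pZ , qZ) ∷ All.map (λ (pX , qX , _) → pX , qX) all ,
    complete′ ,
    All.map (λ (_ , _ , X≉Z) Z≈X → X≉Z (swap Z≈X)) all ∷ distinct
    where
    complete′ : ∀ Y → _ → Any (λ X → X ≈L Y) (Z ∷ ys)
    complete′ Y (pY , qY) with Z ≈L? Y
    ... | yes Z≈Y = here Z≈Y
    ... | no  Z≉Y = there (complete Y (pY , qY , Z≉Y ∘ swap))

  SameTerm : C × List LE → C × List LE → Set
  SameTerm (a , F) (b , G) = a ≈ b × F ≡ G

  coeff-pointwise : ∀ F {xs ys} → Pointwise SameTerm xs ys → coeff F xs ≈ coeff F ys
  coeff-pointwise F []                                   = refl
  coeff-pointwise F {(_ , G) ∷ _} ((a≈b , P.refl) ∷ rest) with eqFlag G F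
  ... | true  = +-cong a≈b (coeff-pointwise F rest)
  ... | false = coeff-pointwise F rest

  coeff-++ : ∀ F xs ys → coeff F (xs ++ ys) ≈ coeff F xs + coeff F ys
  coeff-++ F []             ys = sym (+-identityˡ _)
  coeff-++ F ((a , G) ∷ xs) ys with eqFlag G F
  ... | true  = trans (+-congˡ (coeff-++ F xs ys)) (sym (+-assoc a _ _))
  ... | false = coeff-++ F xs ys

  coeff-scale : ∀ F s xs → coeff F (scale s xs) ≈ s * coeff F xs
  coeff-scale F s []             = sym (zeroʳ s)
  coeff-scale F s ((a , G) ∷ xs) with eqFlag G F
  ... | true  = trans (+-congˡ (coeff-scale F s xs)) (sym (distribˡ s a _))
  ... | false = coeff-scale F s xs

  InSpan-refl : ∀ {Gen : Set} (expand : Gen → FS) xs → InSpan expand (xs -FS xs)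
  InSpan-refl expand xs = [] , λ F → begin
    coeff F (xs ++ scale (- 1#) xs)             ≈⟨ coeff-++ F xs _ ⟩
    coeff F xs + coeff F (scale (- 1#) xs)      ≈⟨ +-congˡ (coeff-scale F (- 1#) xs) ⟩
    coeff F xs + - 1# * coeff F xs              ≈⟨ +-congˡ (-1*x≈-x _) ⟩
    coeff F xs + - coeff F xs                   ≈⟨ -‿inverseʳ _ ⟩
    0#                                          ∎

  tau-fixes : ∀ i j p F → IsFlag p F → LastNotUnder j F → Tau i j p ⟦ F ⟧ ⟦ F ⟧
  tau-fixes i j p F flag F⊈Hj =
    (⟦ F ⟧ , (flag , F⊈Hj) ∷ [] , InSpan-refl relExpand ⟦ F ⟧) , InSpan-refl allExpand ⟦ F ⟧

  -1*-1≈1*1 : - 1# * - 1# ≈ 1# * 1#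
  -1*-1≈1*1 = trans (-1*x≈-x (- 1#)) (trans (⁻¹-involutive 1#) (sym (*-identityʳ 1#)))

  scale-negSum : ∀ (G : LE → List LE) ys →
    Pointwise SameTerm (scale (- 1#) (negSum G ys)) (scale 1# (map (λ X → (1# , G X)) ys))
  scale-negSum G []       = []
  scale-negSum G (_ ∷ ys) = (-1*-1≈1*1 , P.refl) ∷ scale-negSum G ys

  tau-boundary : ∀ i j p pre {B C} → IsFlag p (pre ++ B ∷ C ∷ []) → Under j C → ¬ Under j B →
    ∀ ys → Enumerates (λ X′ → HasCodim X′ p × B <L X′ × ¬ (X′ ≈L C)) ys →
    Tau i j p ⟦ pre ++ B ∷ C ∷ [] ⟧ (negSum (λ X′ → pre ++ B ∷ X′ ∷ []) ys)
  tau-boundary i j p pre {B} {C} flag C⊆Hj B⊈Hj ys ys-enum with flag-length pre flag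
  ... | P.refl =
    (negSum G ys , All.map⁺ (All.map G-in-F⁽ʲ⁾ (proj₁ ys-enum)) ,
     InSpan-refl relExpand (negSum G ys)) ,
    (1# , inj₂ d-init) ∷ [] , λ F → coeff-pointwise F boundary
    where
    G : LE → List LE
    G X′ = pre ++ B ∷ X′ ∷ []

    codimB : HasCodim B (length pre)
    codimB = proj₁ (chainFrom-last₂ 0 pre (proj₂ flag))

    B<C : B <L C
    B<C = proj₁ (proj₂ (chainFrom-last₂ 0 pre (proj₂ flag)))

    codimC : HasCodim C p
    codimC = proj₂ (proj₂ (chainFrom-last₂ 0 pre (proj₂ flag)))

    G-in-F⁽ʲ⁾ : ∀ {X′} → HasCodim X′ p × B <L X′ × ¬ (X′ ≈L C) →
                IsFlag p (G X′) × LastNotUnder j (G X′)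
    G-in-F⁽ʲ⁾ {X′} (codimX′ , B<X′ , X′≉C) =
      flag-replace-last pre flag B<X′ codimX′ ,
      lastNotUnder-++ pre {B} λ X′⊆Hj →
        X′≉C (hyperplane-cover-unique j {B} {X′} {C} codimB codimX′ codimC
                (proj₁ B<X′) (proj₁ B<C) X′⊆Hj C⊆Hj B⊈Hj)

    d-init : DGen
    d-init = dGen (length pre) pre B (flag-init pre flag) (C ∷ ys) (enumerates-∷ codimC B<C ys-enum)

    boundary : Pointwise SameTerm (⟦ G C ⟧ -FS negSum G ys) (scale 1# (dExpand d-init) ++ [])
    boundary = (sym (*-identityʳ 1#) , P.refl) ∷
               P.subst (Pointwise SameTerm _) (P.sym (++-identityʳ _)) (scale-negSum G ys)

-- τ_ij is characterised by its value alone (Tau does not involve i).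
theorem6p3 :
    (K : CommutativeRing 0ℓ 0ℓ) → IsField K → CharZero K → AlgClosed K →
    (ℓ n : ℕ) (A : Arrangement K ℓ n) →
    let open Arr A in
    (i j : Fin (suc n)) → i < j →
    (p : ℕ) → 1 ≤ p → p ≤ ℓ →
    (pre : List LE) (Xp-1 Xp : LE) →
    IsFlag p (pre ++ Xp-1 ∷ Xp ∷ []) →
    ¬ Under i Xp →
    ((¬ Under j Xp →
        Tau i j p ⟦ pre ++ Xp-1 ∷ Xp ∷ [] ⟧ ⟦ pre ++ Xp-1 ∷ Xp ∷ [] ⟧) ×
     (Under j Xp → ¬ Under j Xp-1 →
        (ys : List LE) →
        Enumerates (λ X′ → HasCodim X′ p × Xp-1 <L X′ × ¬ (X′ ≈L Xp)) ys →
        Tau i j p ⟦ pre ++ Xp-1 ∷ Xp ∷ [] ⟧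
                  (negSum (λ X′ → pre ++ Xp-1 ∷ X′ ∷ []) ys)))
theorem6p3 K isField _ _ ℓ n A i j _ p _ _ pre Xp-1 Xp flag _ =
  (λ Xp⊈Hj → tau-fixes i j p _ flag (lastNotUnder-++ pre Xp⊈Hj)) ,
  (λ Xp⊆Hj Xp-1⊈Hj → tau-boundary i j p pre flag Xp⊆Hj Xp-1⊈Hj)
  where open FlagSpace isField A
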